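{- Let $G$ be an ordered group, let $x_1<x_2<x_3$ be elements of $G$ and $S=\{x_1,x_2,x_3\}$. Assume that $\langle S\rangle$ is non-abelian and that either $x_1x_2=x_2x_1$ or $x_2x_3=x_3x_2$. Then $|S^2|=7$ if and only if one of the following holds: (i) $S\cap Z(\langle S\rangle)\neq\emptyset$; (ii) $S=\{a,a^b,b\}$ for some $a,b\in G$ with $aa^b=a^ba$.
   Context: An ordered group is a group $G$ with a total order $\le$ such that $a\le b$ implies $xay\le xby$ for all $a,b,x,y\in G$. For a subset $S$, $S^2=\{x_1x_2 : x_1,x_2\in S\}$, and $\langle S\rangle$ is the subgroup generated by $S$; $Z(H)$ denotes the center of $H$; $a^b=b^{ -1}ab$. -}

module Defs where

open import Level using (Level; _⊔_; suc)
open import Algebra.Bundles using (Group)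
open import Relation.Binary.Structures using (IsTotalOrder)
open import Relation.Binary.Core using (Rel)
open import Data.Fin using (Fin)
open import Data.Nat using (ℕ)
open import Data.Product using (Σ; ∃; ∃-syntax; _×_; _,_)
open import Data.Sum using (_⊎_)
open import Relation.Nullary using (¬_)
open import Relation.Binary.PropositionalEquality using (_≡_)

record OrderedGroup (c ℓ₁ ℓ₂ : Level) : Set (Level.suc (c ⊔ ℓ₁ ⊔ ℓ₂)) where
  field
    group : Group c ℓ₁
  open Group group public
  infix 4 _≤_ _<_
  field
    _≤_ : Rel Carrier ℓ₂
    isTotalOrder : IsTotalOrder _≈_ _≤_
    compatible : ∀ {a b} (x y : Carrier) → a ≤ b → (x ∙ a) ∙ y ≤ (x ∙ b) ∙ y

  _<_ : Rel Carrier (ℓ₁ ⊔ ℓ₂)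
  a < b = (a ≤ b) × ¬ (a ≈ b)

module _ {c ℓ₁ ℓ₂} (G : OrderedGroup c ℓ₁ ℓ₂) where
  open OrderedGroup G

  conj : Carrier → Carrier → Carrier
  conj a b = (b ⁻¹ ∙ a) ∙ b

  In3 : Carrier → Carrier → Carrier → Carrier → Set ℓ₁
  In3 x₁ x₂ x₃ s = s ≈ x₁ ⊎ s ≈ x₂ ⊎ s ≈ x₃

  data InGen {p} (P : Carrier → Set p) : Carrier → Set (c ⊔ ℓ₁ ⊔ p) where
    gen  : ∀ {g} → P g → InGen P g
    unit : InGen P ε
    mul  : ∀ {g h} → InGen P g → InGen P h → InGen P (g ∙ h)
    inv  : ∀ {g} → InGen P g → InGen P (g ⁻¹)
    resp : ∀ {g h} → g ≈ h → InGen P g → InGen P h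

  IsAbelianSub : ∀ {p} → (Carrier → Set p) → Set (c ⊔ ℓ₁ ⊔ p)
  IsAbelianSub H = ∀ g h → H g → H h → g ∙ h ≈ h ∙ g

  InCenter : ∀ {p} → (Carrier → Set p) → Carrier → Set (c ⊔ ℓ₁ ⊔ p)
  InCenter H z = H z × (∀ g → H g → z ∙ g ≈ g ∙ z)

  InSq3 : Carrier → Carrier → Carrier → Carrier → Set (c ⊔ ℓ₁)
  InSq3 x₁ x₂ x₃ g = ∃[ s ] ∃[ t ] In3 x₁ x₂ x₃ s × In3 x₁ x₂ x₃ t × g ≈ s ∙ t

  HasCard : ∀ {p} → (Carrier → Set p) → (n : ℕ) → Set (c ⊔ ℓ₁ ⊔ p)
  HasCard P n = Σ (Fin n → Carrier) λ f →
      (∀ i j → f i ≈ f j → i ≡ j)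
    × (∀ i → P (f i))
    × (∀ g → P g → ∃[ i ] g ≈ f i)

  SameSet : ∀ {p q} → (Carrier → Set p) → (Carrier → Set q) → Set (c ⊔ p ⊔ q)
  SameSet P Q = (∀ g → P g → Q g) × (∀ g → Q g → P g)

{-# OPTIONS --safe #-}
module Submission where

-- Reversing the order if necessary, write S = {a < b < c} with ab = ba; as ⟨S⟩
-- is non-abelian, c does not commute with both a and b. Bi-invariance makes s t
-- strictly monotone in each factor, so two distinct products x_i x_j = x_k x_l
-- can only agree if i < k and l < j. Checking these few crossings among the
-- eight products aa, ab, ac, ca, bb, bc, cb, cc, the only possible coincidences
-- are c x_k = x_m c with x_k, x_m ∈ {a, b}, i.e. x_k = x_m^c, and at most one k
-- occurs (an element of an ordered group commuting with c² commutes with c).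
-- So |S²| = 7 exactly when such a relation holds. With k = m it says that a or
-- b is central in ⟨S⟩, with k ≠ m that S = {x_m, x_m^c, c} where x_m commutes
-- with x_m^c; conversely each condition of the theorem yields such a relation.

open import Defs
open import Data.Empty using (⊥-elim)
open import Data.Fin using (Fin; punchIn; punchOut) renaming (_≟_ to _≟ᶠ_)
open import Data.Fin.Patterns using (0F; 1F; 2F; 3F; 4F; 5F; 6F; 7F)
open import Data.Fin.Properties
  using (pigeonhole; <⇒≢; punchIn-injective; punchInᵢ≢i; punchIn-punchOut)
import Data.Nat as ℕ
open import Data.Nat.Properties using (n<1+n)
open import Data.Product using (Σ; ∃; ∃₂; ∃-syntax; _×_; _,_; proj₁; proj₂)
open import Data.Sum using (_⊎_; inj₁; inj₂)
open import Function using (_∘_; flip)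
open import Function.Bundles using (_⇔_; mk⇔)
import Function.Properties.Equivalence as ⇔
open import Relation.Nullary using (¬_; yes; no)
open import Level using (_⊔_)
open import Relation.Binary.PropositionalEquality
  using (_≡_; _≢_; refl; cong) renaming (sym to ≡-sym; trans to ≡-trans)
open import Relation.Binary.Structures using (IsTotalOrder)
import Relation.Binary.Construct.Flip.EqAndOrd as Flip
import Relation.Binary.Construct.NonStrictToStrict as NonStrictToStrict
import Relation.Binary.Reasoning.Setoid as SetoidReasoning
import Algebra.Properties.Group as GroupProperties

reverse : ∀ {o ℓ₁ ℓ₂} → OrderedGroup o ℓ₁ ℓ₂ → OrderedGroup o ℓ₁ ℓ₂
reverse G = record
  { group        = group
  ; _≤_          = flip _≤_
  ; isTotalOrder = Flip.isTotalOrder isTotalOrder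
  ; compatible   = λ x y → compatible x y
  }
  where open OrderedGroup G

reverse-< : ∀ {o ℓ₁ ℓ₂} (G : OrderedGroup o ℓ₁ ℓ₂) → let open OrderedGroup G in
            ∀ {g h} → g < h → OrderedGroup._<_ (reverse G) h g
reverse-< G (g≤h , g≉h) = g≤h , g≉h ∘ OrderedGroup.sym G

module Subsets {o ℓ₁ ℓ₂} (G : OrderedGroup o ℓ₁ ℓ₂) where
  open OrderedGroup G renaming (refl to ≈-refl)

  SameSet-refl : ∀ {p} {P : Carrier → Set p} → SameSet G P P
  SameSet-refl = (λ _ g∈P → g∈P) , (λ _ g∈P → g∈P)

  SameSet-trans : ∀ {p q r} {P : Carrier → Set p} {Q : Carrier → Set q}
                  {R : Carrier → Set r} → SameSet G P Q → SameSet G Q R → SameSet G P R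
  SameSet-trans (P⊆Q , Q⊆P) (Q⊆R , R⊆Q) =
    (λ g → Q⊆R g ∘ P⊆Q g) , (λ g → Q⊆P g ∘ R⊆Q g)

  In3-cong : ∀ {p q r p′ q′ r′} → p ≈ p′ → q ≈ q′ → r ≈ r′ →
             SameSet G (In3 G p q r) (In3 G p′ q′ r′)
  In3-cong p≈p′ q≈q′ r≈r′ =
    along p≈p′ q≈q′ r≈r′ , along (sym p≈p′) (sym q≈q′) (sym r≈r′)
    where
    along : ∀ {p q r p′ q′ r′} → p ≈ p′ → q ≈ q′ → r ≈ r′ →
            ∀ g → In3 G p q r g → In3 G p′ q′ r′ g
    along p≈p′ _ _ g (inj₁ g≈p)        = inj₁ (trans g≈p p≈p′)
    along _ q≈q′ _ g (inj₂ (inj₁ g≈q)) = inj₂ (inj₁ (trans g≈q q≈q′))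
    along _ _ r≈r′ g (inj₂ (inj₂ g≈r)) = inj₂ (inj₂ (trans g≈r r≈r′))

  In3-swap : ∀ {p q r} → SameSet G (In3 G p q r) (In3 G q p r)
  In3-swap = (λ _ → swap) , (λ _ → swap)
    where
    swap : ∀ {p q r g} → In3 G p q r g → In3 G q p r g
    swap (inj₁ g≈p)        = inj₂ (inj₁ g≈p)
    swap (inj₂ (inj₁ g≈q)) = inj₁ g≈q
    swap (inj₂ (inj₂ g≈r)) = inj₂ (inj₂ g≈r)

  In3-reverse⊆ : ∀ {p q r g} → In3 G p q r g → In3 G r q p g
  In3-reverse⊆ (inj₁ g≈p)        = inj₂ (inj₂ g≈p)
  In3-reverse⊆ (inj₂ (inj₁ g≈q)) = inj₂ (inj₁ g≈q)
  In3-reverse⊆ (inj₂ (inj₂ g≈r)) = inj₁ g≈r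

  In3-reverse : ∀ {p q r} → SameSet G (In3 G p q r) (In3 G r q p)
  In3-reverse = (λ _ → In3-reverse⊆) , (λ _ → In3-reverse⊆)

  InSq3-reverse : ∀ {p q r} → SameSet G (InSq3 G p q r) (InSq3 G r q p)
  InSq3-reverse = (λ _ → reverse⊆) , (λ _ → reverse⊆)
    where
    reverse⊆ : ∀ {p q r g} → InSq3 G p q r g → InSq3 G r q p g
    reverse⊆ (s , t , s∈ , t∈ , g≈st) = s , t , In3-reverse⊆ s∈ , In3-reverse⊆ t∈ , g≈st

  HasCard-cong : ∀ {p q n} {P : Carrier → Set p} {Q : Carrier → Set q} →
                 SameSet G P Q → HasCard G P n → HasCard G Q n
  HasCard-cong (P⊆Q , Q⊆P) (f , f-injective , f∈P , P⊆f) =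
    f , f-injective , (λ i → P⊆Q _ (f∈P i)) , (λ g → P⊆f g ∘ Q⊆P g)

  HasCard-cong-⇔ : ∀ {p q n} {P : Carrier → Set p} {Q : Carrier → Set q} →
                   SameSet G P Q → HasCard G P n ⇔ HasCard G Q n
  HasCard-cong-⇔ (P⊆Q , Q⊆P) = mk⇔ (HasCard-cong (P⊆Q , Q⊆P)) (HasCard-cong (Q⊆P , P⊆Q))

  HasCard-collision : ∀ {p n m} {P : Carrier → Set p} → HasCard G P n →
                      (f : Fin m → Carrier) → (∀ i → P (f i)) → n ℕ.< m →
                      ∃₂ λ i j → i ≢ j × f i ≈ f j
  HasCard-collision (e , _ , _ , P⊆e) f f∈P n<m
    with pigeonhole n<m (λ i → proj₁ (P⊆e (f i) (f∈P i)))
  ... | i , j , i<j , same =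
    i , j , <⇒≢ i<j ,
    trans (proj₂ (P⊆e _ (f∈P i)))
          (trans (reflexive (cong e same)) (sym (proj₂ (P⊆e _ (f∈P j)))))

  HasCard-punchIn : ∀ {p n} {P : Carrier → Set p} (f : Fin (ℕ.suc n) → Carrier) →
                    (∀ i → P (f i)) → (∀ g → P g → ∃ λ i → g ≈ f i) →
                    ∀ d e → d ≢ e → f d ≈ f e →
                    (∀ i j → i ≢ d → j ≢ d → f i ≈ f j → i ≡ j) → HasCard G P n
  HasCard-punchIn {P = P} f f∈P P⊆f d e d≢e fd≈fe injective-off-d =
    f ∘ punchIn d , injective , f∈P ∘ punchIn d , covered
    where
    injective : ∀ i j → f (punchIn d i) ≈ f (punchIn d j) → i ≡ j
    injective i j eq =
      punchIn-injective d i j (injective-off-d _ _ (punchInᵢ≢i d i) (punchInᵢ≢i d j) eq)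
    covered : ∀ g → P g → ∃ λ i → g ≈ f (punchIn d i)
    covered g g∈P with P⊆f g g∈P
    ... | i , g≈fi with d ≟ᶠ i
    ...   | no d≢i   = punchOut d≢i ,
                       trans g≈fi (reflexive (cong f (≡-sym (punchIn-punchOut d≢i))))
    ...   | yes refl = punchOut d≢e ,
                       trans g≈fi
                             (trans fd≈fe (reflexive (cong f (≡-sym (punchIn-punchOut d≢e)))))

module Commutation {o ℓ₁ ℓ₂} (G : OrderedGroup o ℓ₁ ℓ₂) where
  open OrderedGroup G renaming (refl to ≈-refl)
  open GroupProperties group using (\\-leftDividesˡ; //-rightDividesʳ; ∙-cancelˡ)
  open SetoidReasoning setoid

  Commute : Carrier → Carrier → Set ℓ₁
  Commute g h = g ∙ h ≈ h ∙ g

  commute-cong : ∀ {g g′ h h′} → g ≈ g′ → h ≈ h′ → Commute g h → Commute g′ h′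
  commute-cong g≈g′ h≈h′ gh≈hg =
    trans (∙-cong (sym g≈g′) (sym h≈h′)) (trans gh≈hg (∙-cong h≈h′ g≈g′))

  commute-ε : ∀ g → Commute g ε
  commute-ε g = trans (identityʳ g) (sym (identityˡ g))

  commute-∙ : ∀ {g h k} → Commute g h → Commute g k → Commute g (h ∙ k)
  commute-∙ {g} {h} {k} gh≈hg gk≈kg = begin
    g ∙ (h ∙ k)  ≈⟨ assoc g h k ⟨
    (g ∙ h) ∙ k  ≈⟨ ∙-congʳ gh≈hg ⟩
    (h ∙ g) ∙ k  ≈⟨ assoc h g k ⟩
    h ∙ (g ∙ k)  ≈⟨ ∙-congˡ gk≈kg ⟩
    h ∙ (k ∙ g)  ≈⟨ assoc h k g ⟨
    (h ∙ k) ∙ g  ∎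

  commute-⁻¹ : ∀ {g h} → Commute g h → Commute g (h ⁻¹)
  commute-⁻¹ {g} {h} gh≈hg = ∙-cancelˡ h _ _ (begin
    h ∙ (g ∙ h ⁻¹)    ≈⟨ assoc h g (h ⁻¹) ⟨
    (h ∙ g) ∙ h ⁻¹    ≈⟨ ∙-congʳ gh≈hg ⟨
    (g ∙ h) ∙ h ⁻¹    ≈⟨ //-rightDividesʳ h g ⟩
    g                 ≈⟨ \\-leftDividesˡ h g ⟨
    h ∙ (h ⁻¹ ∙ g)    ∎)

  commute-generated : ∀ {p} {P : Carrier → Set p} {z} →
                      (∀ s → P s → Commute z s) → ∀ {g} → InGen G P g → Commute z g
  commute-generated z-P (gen {g} g∈P) = z-P g g∈P
  commute-generated z-P unit           = commute-ε _
  commute-generated z-P (mul g∈ h∈)    =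
    commute-∙ (commute-generated z-P g∈) (commute-generated z-P h∈)
  commute-generated z-P (inv g∈)       = commute-⁻¹ (commute-generated z-P g∈)
  commute-generated z-P (resp g≈h g∈)  = commute-cong ≈-refl g≈h (commute-generated z-P g∈)

  generators-commute⇒abelian : ∀ {p} {P : Carrier → Set p} →
                               (∀ s t → P s → P t → Commute s t) → IsAbelianSub G (InGen G P)
  generators-commute⇒abelian P-commute g h g∈ h∈ =
    commute-generated (λ s s∈P → sym (commute-generated (λ t → P-commute s t s∈P) g∈)) h∈

  ∙-conj : ∀ g h → h ∙ conj G g h ≈ g ∙ h
  ∙-conj g h = begin
    h ∙ ((h ⁻¹ ∙ g) ∙ h)  ≈⟨ assoc h (h ⁻¹ ∙ g) h ⟨
    (h ∙ (h ⁻¹ ∙ g)) ∙ h  ≈⟨ ∙-congʳ (\\-leftDividesˡ h g) ⟩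
    g ∙ h                 ∎

  conj-≈ : ∀ {g h k} → h ∙ k ≈ g ∙ h → conj G g h ≈ k
  conj-≈ {g} {h} {k} hk≈gh = ∙-cancelˡ h _ _ (trans (∙-conj g h) (sym hk≈gh))

module OrderedGroupProperties {o ℓ₁ ℓ₂} (G : OrderedGroup o ℓ₁ ℓ₂) where
  open OrderedGroup G
  open Commutation G
  open GroupProperties group using (∙-cancelˡ; ∙-cancelʳ)
  open IsTotalOrder isTotalOrder
    using (isPartialOrder; antisym; ≤-respˡ-≈; ≤-respʳ-≈) renaming (trans to ≤-trans)

  ∙-monoˡ-≤ : ∀ {g h} k → g ≤ h → g ∙ k ≤ h ∙ k
  ∙-monoˡ-≤ {g} {h} k g≤h =
    ≤-respˡ-≈ (∙-congʳ (identityˡ g))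
              (≤-respʳ-≈ (∙-congʳ (identityˡ h)) (compatible ε k g≤h))

  ∙-monoʳ-≤ : ∀ {g h} k → g ≤ h → k ∙ g ≤ k ∙ h
  ∙-monoʳ-≤ {g} {h} k g≤h =
    ≤-respˡ-≈ (identityʳ (k ∙ g))
              (≤-respʳ-≈ (identityʳ (k ∙ h)) (compatible k ε g≤h))

  ∙-mono-<-≤ : ∀ {g h k l} → g < h → k ≤ l → g ∙ k < h ∙ l
  ∙-mono-<-≤ {g} {h} {k} {l} (g≤h , g≉h) k≤l = ≤-trans gk≤hk hk≤hl , λ gk≈hl →
    g≉h (∙-cancelʳ k g h (antisym gk≤hk (≤-respʳ-≈ (sym gk≈hl) hk≤hl)))
    where
    gk≤hk = ∙-monoˡ-≤ k g≤h
    hk≤hl = ∙-monoʳ-≤ h k≤l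

  ∙-mono-≤-< : ∀ {g h k l} → g ≤ h → k < l → g ∙ k < h ∙ l
  ∙-mono-≤-< {g} {h} {k} {l} g≤h (k≤l , k≉l) = ≤-trans gk≤gl gl≤hl , λ gk≈hl →
    k≉l (∙-cancelˡ g k l (antisym gk≤gl (≤-respʳ-≈ (sym gk≈hl) gl≤hl)))
    where
    gk≤gl = ∙-monoʳ-≤ g k≤l
    gl≤hl = ∙-monoˡ-≤ l g≤h

  -- (g h) h ≤ (h g) h ≈ h (g h) ≤ h (h g), and the two ends agree.
  commute-square-≤ : ∀ {g h} → g ∙ h ≤ h ∙ g → Commute g (h ∙ h) → Commute g h
  commute-square-≤ {g} {h} gh≤hg g-hh = ∙-cancelʳ h _ _
    (antisym (∙-monoˡ-≤ h gh≤hg)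
             (≤-respʳ-≈ (sym ends) (≤-respˡ-≈ (sym (assoc h g h)) (∙-monoʳ-≤ h gh≤hg))))
    where
    ends : (g ∙ h) ∙ h ≈ h ∙ (h ∙ g)
    ends = trans (assoc g h h) (trans g-hh (assoc h h g))

  <-trans : ∀ {g h k} → g < h → h < k → g < k
  <-trans = NonStrictToStrict.<-trans _≈_ _≤_ isPartialOrder

commute-square⇒commute : ∀ {o ℓ₁ ℓ₂} (G : OrderedGroup o ℓ₁ ℓ₂) →
                         let open OrderedGroup G in ∀ {g h} →
                         g ∙ (h ∙ h) ≈ (h ∙ h) ∙ g → g ∙ h ≈ h ∙ g
commute-square⇒commute G {g} {h} g-hh with total (g ∙ h) (h ∙ g)
  where open OrderedGroup G
        open IsTotalOrder isTotalOrder using (total)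
... | inj₁ gh≤hg = OrderedGroupProperties.commute-square-≤ G gh≤hg g-hh
... | inj₂ hg≤gh = OrderedGroupProperties.commute-square-≤ (reverse G) hg≤gh g-hh

data Ix : Set where
  A B C : Ix

infix 4 _⊏_
data _⊏_ : Ix → Ix → Set where
  A⊏B : A ⊏ B
  A⊏C : A ⊏ C
  B⊏C : B ⊏ C

data Ordering (i j : Ix) : Set where
  less    : i ⊏ j → Ordering i j
  equal   : i ≡ j → Ordering i j
  greater : j ⊏ i → Ordering i j

compare : ∀ i j → Ordering i j
compare A A = equal refl
compare A B = less A⊏B
compare A C = less A⊏C
compare B A = greater A⊏B
compare B B = equal refl
compare B C = less B⊏C
compare C A = greater A⊏C
compare C B = greater B⊏C
compare C C = equal refl

triple : ∀ {a} {X : Set a} → X → X → X → Ix → X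
triple a b c A = a
triple a b c B = b
triple a b c C = c

Pair : Set
Pair = Ix × Ix

Crossing : Pair → Pair → Set
Crossing (i , j) (k , l) = i ⊏ k × l ⊏ j

-- The eight pairs other than (B , A), whose products exhaust S² when ab = ba.
word : Fin 8 → Pair
word 0F = A , A
word 1F = A , B
word 2F = A , C
word 3F = B , B
word 4F = B , C
word 5F = C , A
word 6F = C , B
word 7F = C , C

-- (B , A) gets the position of (A , B), which has the same product.
index : Pair → Fin 8
index (A , A) = 0F
index (A , B) = 1F
index (A , C) = 2F
index (B , A) = 1F
index (B , B) = 3F
index (B , C) = 4F
index (C , A) = 5F
index (C , B) = 6F
index (C , C) = 7F

index-word : ∀ i → index (word i) ≡ i
index-word 0F = refl
index-word 1F = refl
index-word 2F = refl
index-word 3F = refl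
index-word 4F = refl
index-word 5F = refl
index-word 6F = refl
index-word 7F = refl

word-injective : ∀ {i j} → word i ≡ word j → i ≡ j
word-injective {i} {j} eq =
  ≡-trans (≡-sym (index-word i)) (≡-trans (cong index eq) (index-word j))

word-≢BA : ∀ i → word i ≢ (B , A)
word-≢BA 0F ()
word-≢BA 1F ()
word-≢BA 2F ()
word-≢BA 3F ()
word-≢BA 4F ()
word-≢BA 5F ()
word-≢BA 6F ()
word-≢BA 7F ()

index-C∙≢index-∙C : ∀ k {m} → m ⊏ C → index (C , k) ≢ index (m , C)
index-C∙≢index-∙C A A⊏C ()
index-C∙≢index-∙C A B⊏C ()
index-C∙≢index-∙C B A⊏C ()
index-C∙≢index-∙C B B⊏C ()
index-C∙≢index-∙C C A⊏C ()
index-C∙≢index-∙C C B⊏C ()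

module Triple {o ℓ₁ ℓ₂} (G : OrderedGroup o ℓ₁ ℓ₂) (a b c : OrderedGroup.Carrier G) where
  open OrderedGroup G renaming (refl to ≈-refl)
  open GroupProperties group using (∙-cancelˡ; ∙-cancelʳ)

  x : Ix → Carrier
  x = triple a b c

  prod : Pair → Carrier
  prod (i , j) = x i ∙ x j

  x∈S : ∀ i → In3 G a b c (x i)
  x∈S A = inj₁ ≈-refl
  x∈S B = inj₂ (inj₁ ≈-refl)
  x∈S C = inj₂ (inj₂ ≈-refl)

  S-index : ∀ {g} → In3 G a b c g → ∃ λ i → g ≈ x i
  S-index (inj₁ g≈a)        = A , g≈a
  S-index (inj₂ (inj₁ g≈b)) = B , g≈b
  S-index (inj₂ (inj₂ g≈c)) = C , g≈c

  prod∈S² : ∀ p → InSq3 G a b c (prod p)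
  prod∈S² (i , j) = x i , x j , x∈S i , x∈S j , ≈-refl

  -- x k = (x m)^c with m below C.
  Conjugacy : Ix → Set ℓ₁
  Conjugacy k = ∃ λ m → m ⊏ C × c ∙ x k ≈ x m ∙ c

  module Distinct (a≉b : ¬ a ≈ b) (b≉c : ¬ b ≈ c) (a≉c : ¬ a ≈ c) where

    ⊏⇒≉ : ∀ {i j} → i ⊏ j → ¬ x i ≈ x j
    ⊏⇒≉ A⊏B = a≉b
    ⊏⇒≉ A⊏C = a≉c
    ⊏⇒≉ B⊏C = b≉c

    x-injective : ∀ {i j} → x i ≈ x j → i ≡ j
    x-injective {i} {j} xi≈xj with compare i j
    ... | less i⊏j    = ⊥-elim (⊏⇒≉ i⊏j xi≈xj)
    ... | equal i≡j   = i≡j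
    ... | greater j⊏i = ⊥-elim (⊏⇒≉ j⊏i (sym xi≈xj))

    ¬conjugacy-C : ¬ Conjugacy C
    ¬conjugacy-C (m , m⊏C , cc≈mc) = ⊏⇒≉ m⊏C (sym (∙-cancelʳ c c (x m) cc≈mc))

    relation⇒conjugacy : ∀ k m → c ∙ x k ≈ x m ∙ c → Σ Ix Conjugacy ⊎ (k ≡ C × m ≡ C)
    relation⇒conjugacy k m ck≈mc with compare m C
    ... | less m⊏C   = inj₁ (k , m , m⊏C , ck≈mc)
    ... | equal refl = inj₂ (x-injective (∙-cancelˡ c (x k) c ck≈mc) , refl)
    ... | greater ()

module _ {o ℓ₁ ℓ₂} (G : OrderedGroup o ℓ₁ ℓ₂) where
  open OrderedGroup G renaming (refl to ≈-refl)

  module Counting (a b c : Carrier) (a<b : a < b) (b<c : b < c) (ab≈ba : a ∙ b ≈ b ∙ a)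
    (¬ac-bc : ¬ (a ∙ c ≈ c ∙ a × b ∙ c ≈ c ∙ b)) where

    open GroupProperties group using (∙-cancelˡ; ∙-cancelʳ; y≈x\\z; x≈z//y)
    open IsTotalOrder isTotalOrder using () renaming (refl to ≤-refl)
    open SetoidReasoning setoid
    open Subsets G
    open Commutation G
    open OrderedGroupProperties G
    open Triple G a b c

    x-mono : ∀ {i j} → i ⊏ j → x i < x j
    x-mono A⊏B = a<b
    x-mono A⊏C = <-trans a<b b<c
    x-mono B⊏C = b<c

    x-≤ : ∀ {i j} → i ⊏ j → x i ≤ x j
    x-≤ = proj₁ ∘ x-mono

    open Distinct (proj₂ a<b) (proj₂ b<c) (proj₂ (x-mono A⊏C))

    classify : ∀ {p q} → p ≢ q → prod p ≈ prod q → Crossing p q ⊎ Crossing q p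
    classify {i , j} {k , l} p≢q e with compare i k | compare j l
    ... | less i⊏k    | less j⊏l    = ⊥-elim (proj₂ (∙-mono-<-≤ (x-mono i⊏k) (x-≤ j⊏l)) e)
    ... | less i⊏k    | equal refl  = ⊥-elim (proj₂ (∙-mono-<-≤ (x-mono i⊏k) ≤-refl) e)
    ... | less i⊏k    | greater l⊏j = inj₁ (i⊏k , l⊏j)
    ... | equal refl  | less j⊏l    = ⊥-elim (proj₂ (∙-mono-≤-< ≤-refl (x-mono j⊏l)) e)
    ... | equal refl  | equal refl  = ⊥-elim (p≢q refl)
    ... | equal refl  | greater l⊏j = ⊥-elim (proj₂ (∙-mono-≤-< ≤-refl (x-mono l⊏j)) (sym e))
    ... | greater k⊏i | less j⊏l    = inj₂ (k⊏i , j⊏l)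
    ... | greater k⊏i | equal refl  = ⊥-elim (proj₂ (∙-mono-<-≤ (x-mono k⊏i) ≤-refl) (sym e))
    ... | greater k⊏i | greater l⊏j = ⊥-elim (proj₂ (∙-mono-<-≤ (x-mono k⊏i) (x-≤ l⊏j)) (sym e))

    ⟨a,b⟩ : Carrier → Set (o ⊔ ℓ₁)
    ⟨a,b⟩ = InGen G (λ g → g ≈ a ⊎ g ≈ b)

    a∈ : ⟨a,b⟩ a
    a∈ = gen (inj₁ ≈-refl)

    b∈ : ⟨a,b⟩ b
    b∈ = gen (inj₂ ≈-refl)

    c∉⟨a,b⟩ : ¬ ⟨a,b⟩ c
    c∉⟨a,b⟩ c∈ = ¬ac-bc (commute-generated a-ab c∈ , commute-generated b-ab c∈)
      where
      a-ab : ∀ s → s ≈ a ⊎ s ≈ b → Commute a s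
      a-ab s (inj₁ s≈a) = commute-cong ≈-refl (sym s≈a) ≈-refl
      a-ab s (inj₂ s≈b) = commute-cong ≈-refl (sym s≈b) ab≈ba
      b-ab : ∀ s → s ≈ a ⊎ s ≈ b → Commute b s
      b-ab s (inj₁ s≈a) = commute-cong ≈-refl (sym s≈a) (sym ab≈ba)
      b-ab s (inj₂ s≈b) = commute-cong ≈-refl (sym s≈b) ≈-refl

    ac≉bb : ¬ a ∙ c ≈ b ∙ b
    ac≉bb ac≈bb = c∉⟨a,b⟩ (resp (sym (y≈x\\z a c (b ∙ b) ac≈bb)) (mul (inv a∈) (mul b∈ b∈)))

    bb≉ca : ¬ b ∙ b ≈ c ∙ a
    bb≉ca bb≈ca = c∉⟨a,b⟩ (resp (sym (x≈z//y c a (b ∙ b) (sym bb≈ca))) (mul (mul b∈ b∈) (inv a∈)))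

    ab≉ca : ¬ a ∙ b ≈ c ∙ a
    ab≉ca ab≈ca = proj₂ b<c (∙-cancelʳ a b c (trans (sym ab≈ba) ab≈ca))

    crossing-conjugacy : ∀ {p q} → q ≢ (B , A) → Crossing p q → prod p ≈ prod q →
                         ∃ λ k → q ≡ (C , k) × Conjugacy k
    crossing-conjugacy q≢BA (A⊏B , A⊏B) _ = ⊥-elim (q≢BA refl)
    crossing-conjugacy q≢BA (A⊏B , A⊏C) _ = ⊥-elim (q≢BA refl)
    crossing-conjugacy _    (A⊏B , B⊏C) e = ⊥-elim (ac≉bb e)
    crossing-conjugacy _    (A⊏C , A⊏B) e = ⊥-elim (ab≉ca e)
    crossing-conjugacy _    (A⊏C , A⊏C) e = A , refl , A , A⊏C , sym e
    crossing-conjugacy _    (A⊏C , B⊏C) e = B , refl , A , A⊏C , sym e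
    crossing-conjugacy _    (B⊏C , A⊏B) e = ⊥-elim (bb≉ca e)
    crossing-conjugacy _    (B⊏C , A⊏C) e = A , refl , B , B⊏C , sym e
    crossing-conjugacy _    (B⊏C , B⊏C) e = B , refl , B , B⊏C , sym e

    conjugacies-clash : ¬ (Conjugacy A × Conjugacy B)
    conjugacies-clash ((A , _ , ca≈ac) , (A , _ , cb≈ac)) =
      proj₂ a<b (∙-cancelˡ c a b (trans ca≈ac (sym cb≈ac)))
    conjugacies-clash ((B , _ , ca≈bc) , (B , _ , cb≈bc)) =
      proj₂ a<b (∙-cancelˡ c a b (trans ca≈bc (sym cb≈bc)))
    conjugacies-clash ((A , _ , ca≈ac) , (B , _ , cb≈bc)) = ¬ac-bc (sym ca≈ac , sym cb≈bc)
    conjugacies-clash ((B , _ , ca≈bc) , (A , _ , cb≈ac)) =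
      proj₂ a<b (∙-cancelˡ c a b (trans (sym ac≈ca) (sym cb≈ac)))
      where
      ac≈ca : a ∙ c ≈ c ∙ a
      ac≈ca = commute-square⇒commute G (begin
        a ∙ (c ∙ c)  ≈⟨ assoc a c c ⟨
        (a ∙ c) ∙ c  ≈⟨ ∙-congʳ cb≈ac ⟨
        (c ∙ b) ∙ c  ≈⟨ assoc c b c ⟩
        c ∙ (b ∙ c)  ≈⟨ ∙-congˡ ca≈bc ⟨
        c ∙ (c ∙ a)  ≈⟨ assoc c c a ⟨
        (c ∙ c) ∙ a  ∎)

    conjugacy-unique : ∀ {k k′} → Conjugacy k → Conjugacy k′ → k ≡ k′
    conjugacy-unique {A} {A} _ _ = refl
    conjugacy-unique {B} {B} _ _ = refl
    conjugacy-unique {A} {B} α β = ⊥-elim (conjugacies-clash (α , β))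
    conjugacy-unique {B} {A} α β = ⊥-elim (conjugacies-clash (β , α))
    conjugacy-unique {C} α _ = ⊥-elim (¬conjugacy-C α)
    conjugacy-unique {_} {C} _ β = ⊥-elim (¬conjugacy-C β)

    prod-index : ∀ p → prod (word (index p)) ≈ prod p
    prod-index (A , A) = ≈-refl
    prod-index (A , B) = ≈-refl
    prod-index (A , C) = ≈-refl
    prod-index (B , A) = ab≈ba
    prod-index (B , B) = ≈-refl
    prod-index (B , C) = ≈-refl
    prod-index (C , A) = ≈-refl
    prod-index (C , B) = ≈-refl
    prod-index (C , C) = ≈-refl

    coincidence : ∀ {i j} → i ≢ j → prod (word i) ≈ prod (word j) →
                  ∃ λ k → (word i ≡ (C , k) ⊎ word j ≡ (C , k)) × Conjugacy k
    coincidence {i} {j} i≢j e with classify (i≢j ∘ word-injective) e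
    ... | inj₁ crossing with crossing-conjugacy (word-≢BA j) crossing e
    ...   | k , wj≡Ck , α = k , inj₂ wj≡Ck , α
    coincidence {i} {j} i≢j e | inj₂ crossing
      with crossing-conjugacy (word-≢BA i) crossing (sym e)
    ...   | k , wi≡Ck , α = k , inj₁ wi≡Ck , α

    S²-covered : ∀ g → InSq3 G a b c g → ∃ λ i → g ≈ prod (word i)
    S²-covered g (s , t , s∈ , t∈ , g≈st) with S-index s∈ | S-index t∈
    ... | u , s≈xu | v , t≈xv =
      index (u , v) , trans g≈st (trans (∙-cong s≈xu t≈xv) (sym (prod-index (u , v))))

    card7⇒conjugacy : HasCard G (InSq3 G a b c) 7 → Σ Ix Conjugacy
    card7⇒conjugacy card
      with HasCard-collision card (prod ∘ word) (prod∈S² ∘ word) (n<1+n 7)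
    ... | i , j , i≢j , e with coincidence i≢j e
    ...   | k , _ , α = k , α

    conjugacy⇒card7 : Σ Ix Conjugacy → HasCard G (InSq3 G a b c) 7
    conjugacy⇒card7 (k , α@(m , m⊏C , ck≈mc)) =
      HasCard-punchIn (prod ∘ word) (prod∈S² ∘ word) S²-covered
        (index (C , k)) (index (m , C)) (index-C∙≢index-∙C k m⊏C)
        (trans (prod-index (C , k)) (trans ck≈mc (sym (prod-index (m , C)))))
        injective-off
      where
      -- Any other coincidence would come from a conjugacy, and that must be α.
      at-Ck : ∀ {l k′} → word l ≡ (C , k′) → Conjugacy k′ → l ≡ index (C , k)
      at-Ck {l} wl≡Ck′ β = ≡-trans (≡-sym (index-word l))
        (≡-trans (cong index wl≡Ck′) (cong (λ k′ → index (C , k′)) (conjugacy-unique β α)))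
      injective-off : ∀ i j → i ≢ index (C , k) → j ≢ index (C , k) →
                      prod (word i) ≈ prod (word j) → i ≡ j
      injective-off i j i≢d j≢d e with i ≟ᶠ j
      ... | yes i≡j = i≡j
      ... | no i≢j with coincidence i≢j e
      ...   | _ , inj₁ wi≡Ck′ , β = ⊥-elim (i≢d (at-Ck wi≡Ck′ β))
      ...   | _ , inj₂ wj≡Ck′ , β = ⊥-elim (j≢d (at-Ck wj≡Ck′ β))

    card7⇔conjugacy : HasCard G (InSq3 G a b c) 7 ⇔ Σ Ix Conjugacy
    card7⇔conjugacy = mk⇔ card7⇒conjugacy conjugacy⇒card7

  module Characterisation (a b c : Carrier) (a≉b : ¬ a ≈ b) (b≉c : ¬ b ≈ c) (a≉c : ¬ a ≈ c)
    (ab≈ba : a ∙ b ≈ b ∙ a) {p} (P : Carrier → Set p) (P≐S : SameSet G P (In3 G a b c))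
    (nonabelian : ¬ IsAbelianSub G (InGen G P)) where

    open Subsets G
    open Commutation G
    open Triple G a b c
    open Distinct a≉b b≉c a≉c

    CentralOrConjugatePair : Set (o ⊔ ℓ₁ ⊔ p)
    CentralOrConjugatePair =
      (∃[ s ] (P s × InCenter G (InGen G P) s))
      ⊎ (∃[ a′ ] ∃[ b′ ] (SameSet G P (In3 G a′ (conj G a′ b′) b′)
                         × a′ ∙ conj G a′ b′ ≈ conj G a′ b′ ∙ a′))

    P-index : ∀ {g} → P g → ∃ λ i → g ≈ x i
    P-index g∈P = S-index (proj₁ P≐S _ g∈P)

    x∈P : ∀ i → P (x i)
    x∈P i = proj₂ P≐S _ (x∈S i)

    x∈⟨P⟩ : ∀ i → InGen G P (x i)
    x∈⟨P⟩ = gen ∘ x∈P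

    ¬ac-bc : ¬ (a ∙ c ≈ c ∙ a × b ∙ c ≈ c ∙ b)
    ¬ac-bc (ac≈ca , bc≈cb) = nonabelian (generators-commute⇒abelian P-commute)
      where
      ⊏-commute : ∀ {i j} → i ⊏ j → Commute (x i) (x j)
      ⊏-commute A⊏B = ab≈ba
      ⊏-commute A⊏C = ac≈ca
      ⊏-commute B⊏C = bc≈cb
      x-commute : ∀ i j → Commute (x i) (x j)
      x-commute i j with compare i j
      ... | less i⊏j    = ⊏-commute i⊏j
      ... | equal refl  = ≈-refl
      ... | greater j⊏i = sym (⊏-commute j⊏i)
      P-commute : ∀ s t → P s → P t → Commute s t
      P-commute s t s∈ t∈ with P-index s∈ | P-index t∈
      ... | i , s≈xi | j , t≈xj = commute-cong (sym s≈xi) (sym t≈xj) (x-commute i j)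

    central : ∀ {z} → (∀ i → Commute z (x i)) → ∀ g → InGen G P g → Commute z g
    central z-x _ = commute-generated λ s s∈P →
      commute-cong ≈-refl (sym (proj₂ (P-index s∈P))) (z-x (proj₁ (P-index s∈P)))

    conjugacy⇒central-or-conjugate-pair : Σ Ix Conjugacy → CentralOrConjugatePair
    conjugacy⇒central-or-conjugate-pair (A , A , _ , ca≈ac) =
      inj₁ (a , x∈P A , x∈⟨P⟩ A , central a-x)
      where
      a-x : ∀ i → Commute a (x i)
      a-x A = ≈-refl
      a-x B = ab≈ba
      a-x C = sym ca≈ac
    conjugacy⇒central-or-conjugate-pair (B , B , _ , cb≈bc) =
      inj₁ (b , x∈P B , x∈⟨P⟩ B , central b-x)
      where
      b-x : ∀ i → Commute b (x i)
      b-x A = sym ab≈ba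
      b-x B = ≈-refl
      b-x C = sym cb≈bc
    conjugacy⇒central-or-conjugate-pair (A , B , _ , ca≈bc) =
      inj₂ (b , c ,
            SameSet-trans P≐S (SameSet-trans In3-swap (In3-cong ≈-refl (sym bᶜ≈a) ≈-refl)) ,
            commute-cong ≈-refl (sym bᶜ≈a) (sym ab≈ba))
      where
      bᶜ≈a : conj G b c ≈ a
      bᶜ≈a = conj-≈ ca≈bc
    conjugacy⇒central-or-conjugate-pair (B , A , _ , cb≈ac) =
      inj₂ (a , c , SameSet-trans P≐S (In3-cong ≈-refl (sym aᶜ≈b) ≈-refl) ,
            commute-cong ≈-refl (sym aᶜ≈b) ab≈ba)
      where
      aᶜ≈b : conj G a c ≈ b
      aᶜ≈b = conj-≈ cb≈ac
    conjugacy⇒central-or-conjugate-pair (C , α) = ⊥-elim (¬conjugacy-C α)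

    A∉CCC : ¬ (A ≡ C ⊎ A ≡ C ⊎ A ≡ C)
    A∉CCC (inj₁ ())
    A∉CCC (inj₂ (inj₁ ()))
    A∉CCC (inj₂ (inj₂ ()))

    commute-c⇒conjugacy : ∀ w → c ∙ x w ≈ x w ∙ c → A ≡ C ⊎ A ≡ C ⊎ A ≡ w → Σ Ix Conjugacy
    commute-c⇒conjugacy w cw≈wc A∈ with relation⇒conjugacy w w cw≈wc
    ... | inj₁ conjugacy = conjugacy
    ... | inj₂ (refl , _) = ⊥-elim (A∉CCC A∈)

    -- u, v, w are the positions of a′, a′^b′ and b′ in S.
    conjugate-triple⇒conjugacy : ∀ u v w → Commute (x u) (x v) → x w ∙ x v ≈ x u ∙ x w →
                                 C ≡ u ⊎ C ≡ v ⊎ C ≡ w → A ≡ u ⊎ A ≡ v ⊎ A ≡ w →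
                                 Σ Ix Conjugacy
    conjugate-triple⇒conjugacy u v w _ cv≈uc (inj₂ (inj₂ refl)) A∈
      with relation⇒conjugacy v u cv≈uc
    ... | inj₁ conjugacy   = conjugacy
    ... | inj₂ (refl , refl) = ⊥-elim (A∉CCC A∈)
    conjugate-triple⇒conjugacy u v w cv≈vc wc≈cw (inj₁ refl) A∈
      with relation⇒conjugacy v v cv≈vc
    ... | inj₁ conjugacy = conjugacy
    ... | inj₂ (refl , _) = commute-c⇒conjugacy w (sym wc≈cw) A∈
    conjugate-triple⇒conjugacy u v w uc≈cu wc≈cw (inj₂ (inj₁ refl)) A∈
      with relation⇒conjugacy u u (sym uc≈cu)
    ... | inj₁ conjugacy = conjugacy
    ... | inj₂ (refl , _) = commute-c⇒conjugacy w (sym wc≈cw) A∈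

    central⇒conjugacy : ∀ u → (∀ i → Commute (x u) (x i)) → Σ Ix Conjugacy
    central⇒conjugacy u u-x with relation⇒conjugacy u u (sym (u-x C))
    ... | inj₁ conjugacy = conjugacy
    ... | inj₂ (refl , _) = ⊥-elim (¬ac-bc (sym (u-x A) , sym (u-x B)))

    central-or-conjugate-pair⇒conjugacy : CentralOrConjugatePair → Σ Ix Conjugacy
    central-or-conjugate-pair⇒conjugacy (inj₁ (s , s∈P , _ , s-central)) with P-index s∈P
    ... | u , s≈xu =
      central⇒conjugacy u λ i → commute-cong s≈xu ≈-refl (s-central (x i) (x∈⟨P⟩ i))
    central-or-conjugate-pair⇒conjugacy (inj₂ (a′ , b′ , P≐T , a′-commutes))
      with P-index (proj₂ P≐T _ (inj₁ ≈-refl))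
         | P-index (proj₂ P≐T _ (inj₂ (inj₁ ≈-refl)))
         | P-index (proj₂ P≐T _ (inj₂ (inj₂ ≈-refl)))
    ... | u , a′≈xu | v , a′ᵇ′≈xv | w , b′≈xw =
      conjugate-triple⇒conjugacy u v w (commute-cong a′≈xu a′ᵇ′≈xv a′-commutes) wv≈uw
        (position C) (position A)
      where
      wv≈uw : x w ∙ x v ≈ x u ∙ x w
      wv≈uw = trans (∙-cong (sym b′≈xw) (sym a′ᵇ′≈xv))
                    (trans (∙-conj a′ b′) (∙-cong a′≈xu b′≈xw))
      position : ∀ i → i ≡ u ⊎ i ≡ v ⊎ i ≡ w
      position i with proj₁ P≐T _ (x∈P i)
      ... | inj₁ xi≈a′          = inj₁ (x-injective (trans xi≈a′ a′≈xu))
      ... | inj₂ (inj₁ xi≈a′ᵇ′) = inj₂ (inj₁ (x-injective (trans xi≈a′ᵇ′ a′ᵇ′≈xv)))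
      ... | inj₂ (inj₂ xi≈b′)   = inj₂ (inj₂ (x-injective (trans xi≈b′ b′≈xw)))

    conjugacy⇔central-or-conjugate-pair : Σ Ix Conjugacy ⇔ CentralOrConjugatePair
    conjugacy⇔central-or-conjugate-pair =
      mk⇔ conjugacy⇒central-or-conjugate-pair central-or-conjugate-pair⇒conjugacy

proposition5p1 : ∀ {c ℓ₁ ℓ₂} (G : OrderedGroup c ℓ₁ ℓ₂) →
    let open OrderedGroup G in
    (x₁ x₂ x₃ : Carrier) → x₁ < x₂ → x₂ < x₃ →
    ¬ IsAbelianSub G (InGen G (In3 G x₁ x₂ x₃)) →
    (x₁ ∙ x₂ ≈ x₂ ∙ x₁ ⊎ x₂ ∙ x₃ ≈ x₃ ∙ x₂) →
    (HasCard G (InSq3 G x₁ x₂ x₃) 7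
      ⇔ ((∃[ s ] (In3 G x₁ x₂ x₃ s × InCenter G (InGen G (In3 G x₁ x₂ x₃)) s))
         ⊎ (∃[ a ] ∃[ b ] (SameSet G (In3 G x₁ x₂ x₃) (In3 G a (conj G a b) b)
                           × a ∙ conj G a b ≈ conj G a b ∙ a))))
proposition5p1 G x₁ x₂ x₃ x₁<x₂ x₂<x₃ nonabelian (inj₁ x₁x₂≈x₂x₁) =
  ⇔.trans (Counting.card7⇔conjugacy G x₁ x₂ x₃ x₁<x₂ x₂<x₃ x₁x₂≈x₂x₁ ¬ac-bc)
          conjugacy⇔central-or-conjugate-pair
  where
  open OrderedGroup G using (_<_)
  x₁<x₃ : x₁ < x₃
  x₁<x₃ = OrderedGroupProperties.<-trans G x₁<x₂ x₂<x₃
  open Characterisation G x₁ x₂ x₃ (proj₂ x₁<x₂) (proj₂ x₂<x₃) (proj₂ x₁<x₃) x₁x₂≈x₂x₁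
         (In3 G x₁ x₂ x₃) (Subsets.SameSet-refl G) nonabelian
proposition5p1 G x₁ x₂ x₃ x₁<x₂ x₂<x₃ nonabelian (inj₂ x₂x₃≈x₃x₂) =
  ⇔.trans (Subsets.HasCard-cong-⇔ G (Subsets.InSq3-reverse G))
    (⇔.trans (Counting.card7⇔conjugacy (reverse G) x₃ x₂ x₁
                (reverse-< G x₂<x₃) (reverse-< G x₁<x₂) (sym x₂x₃≈x₃x₂) ¬ac-bc)
             conjugacy⇔central-or-conjugate-pair)
  where
  open OrderedGroup G using (_<_; sym)
  x₁<x₃ : x₁ < x₃
  x₁<x₃ = OrderedGroupProperties.<-trans G x₁<x₂ x₂<x₃
  open Characterisation G x₃ x₂ x₁
         (proj₂ (reverse-< G x₂<x₃)) (proj₂ (reverse-< G x₁<x₂)) (proj₂ (reverse-< G x₁<x₃))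
         (sym x₂x₃≈x₃x₂) (In3 G x₁ x₂ x₃) (Subsets.In3-reverse G) nonabelian
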